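{- Let $g\colon\{0,1,2\}^*\to\{0,1,2,3\}^*$ be the morphism $g(0)=103230$, $g(1)=1030$, $g(2)=12$. Let $w$ be an infinite Dean word such that $\{101,123,212,232,303,321\}\subseteq \mathit{D}_3(w)$. Then $w=u\,g(v)$ where $u$ is a finite word with $|u|\le 5$ and $v$ is an infinite square-free word over $\{0,1,2\}$.
   Context: Words are over the alphabet $\Sigma_4=\{0,1,2,3\}$. A word is reduced if it has no factor in $\{02,20,13,31\}$. A Dean word is a finite or infinite reduced word that is square-free (no factor $uu$ with $u$ nonempty). For a Dean word $w$, $\mathit{D}_3(w)$ is the set of reduced words $v$ of length $3$ that are not factors of $w$ but whose prefix and suffix of length $2$ are factors of $w$. A morphism is extended to infinite words letterwise. -}

module Defs where

open import Data.Nat using (ℕ; zero; suc; _+_; _≤_; _<_)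
open import Data.Fin using (Fin; zero; suc)
open import Data.List using (List; []; _∷_; _++_; length; map; concatMap)
open import Data.Product using (∃; _×_)
open import Relation.Binary.PropositionalEquality using (_≡_; _≢_)
open import Relation.Nullary using (¬_)
open import Data.Empty using (⊥)
open import Data.Unit using (⊤)

Σ₄ : Set
Σ₄ = Fin 4

Σ₃ : Set
Σ₃ = Fin 3

InfWord : Set → Set
InfWord A = ℕ → A

factorAt : {A : Set} → InfWord A → ℕ → ℕ → List A
factorAt w i zero    = []
factorAt w i (suc n) = w i ∷ factorAt w (suc i) n

prefix : {A : Set} → InfWord A → ℕ → List A
prefix w n = factorAt w 0 n

IsFactor : {A : Set} → List A → InfWord A → Set
IsFactor x w = ∃ λ i → factorAt w i (length x) ≡ x

Forbidden : Σ₄ → Σ₄ → Set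
Forbidden zero (suc (suc zero)) = ⊤
Forbidden (suc (suc zero)) zero = ⊤
Forbidden (suc zero) (suc (suc (suc zero))) = ⊤
Forbidden (suc (suc (suc zero))) (suc zero) = ⊤
Forbidden _ _ = ⊥

Reduced : List Σ₄ → Set
Reduced [] = ⊤
Reduced (a ∷ []) = ⊤
Reduced (a ∷ b ∷ x) = ¬ Forbidden a b × Reduced (b ∷ x)

ReducedInf : InfWord Σ₄ → Set
ReducedInf w = ∀ i → ¬ Forbidden (w i) (w (suc i))

SquareFreeInf : {A : Set} → InfWord A → Set
SquareFreeInf w = ∀ i n → 1 ≤ n → factorAt w i n ≢ factorAt w (i + n) n

DeanInf : InfWord Σ₄ → Set
DeanInf w = ReducedInf w × SquareFreeInf w

InD3 : InfWord Σ₄ → Σ₄ → Σ₄ → Σ₄ → Set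
InD3 w a b c =
  Reduced (a ∷ b ∷ c ∷ []) ×
  (¬ IsFactor (a ∷ b ∷ c ∷ []) w) ×
  IsFactor (a ∷ b ∷ []) w ×
  IsFactor (b ∷ c ∷ []) w

l0 l1 l2 l3 : Σ₄
l0 = zero
l1 = suc zero
l2 = suc (suc zero)
l3 = suc (suc (suc zero))

gLetter : Σ₃ → List Σ₄
gLetter zero = l1 ∷ l0 ∷ l3 ∷ l2 ∷ l3 ∷ l0 ∷ []
gLetter (suc zero) = l1 ∷ l0 ∷ l3 ∷ l0 ∷ []
gLetter (suc (suc zero)) = l1 ∷ l2 ∷ []

g : List Σ₃ → List Σ₄
g = concatMap gLetter

-- w = u g(v) for infinite v: for every n, the prefix of w of length
-- |u| + |g(v[0..n))| equals u ++ g(v[0..n)).  (Since |g(a)| ≥ 2, these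
-- prefixes have unbounded length, so this determines w completely.)
EqConcatImage : InfWord Σ₄ → List Σ₄ → InfWord Σ₃ → Set
EqConcatImage w u v =
  ∀ n → prefix w (length u + length (g (prefix v n))) ≡ u ++ g (prefix v n)

{-# OPTIONS --safe #-}
module Submission where

-- In a reduced word consecutive letters are neighbours on the cycle 0–1–2–3–0,
-- and square-freeness rules out aa, so w is a walk on this cycle. Removing the six
-- words of D₃(w) from the possible triples leaves ten, and these force the letters
-- after each occurrence of 1 to be 12·1, 1030·1 or 103230·1, i.e. g(2), g(1) or g(0)
-- followed by 1. Hence w cuts at its occurrences of 1 into g-blocks, and the first 1
-- occurs among the first six letters. A square xx in v would give the square
-- g(x)g(x) in w.

open import Defs
open import Data.Nat using (ℕ; zero; suc; _+_; _≤_; _<_; z≤n; s≤s)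
open import Data.Nat.Properties using (+-identityʳ; +-suc; +-assoc; +-comm; ≤-pred; ≤-trans; m≤m+n)
open import Data.Fin using (zero; suc)
open import Data.List using (List; []; _∷_; _++_; length; concatMap)
open import Data.List.Properties using (length-++; length-++-≤ˡ; length-++-sucʳ; ∷-injective)
open import Data.Product using (Σ; ∃; ∃₂; _×_; _,_; proj₁; proj₂)
open import Data.Empty using (⊥-elim)
open import Data.Unit using (⊤; tt)
open import Relation.Nullary using (¬_)
open import Relation.Binary.PropositionalEquality
open ≡-Reasoning

factorAt-+ : {A : Set} (w : InfWord A) → ∀ i m n →
  factorAt w i (m + n) ≡ factorAt w i m ++ factorAt w (i + m) n
factorAt-+ w i zero n = cong (λ k → factorAt w k n) (sym (+-identityʳ i))
factorAt-+ w i (suc m) n = cong (w i ∷_) (begin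
  factorAt w (suc i) (m + n)                       ≡⟨ factorAt-+ w (suc i) m n ⟩
  factorAt w (suc i) m ++ factorAt w (suc i + m) n ≡⟨ cong (λ k → factorAt w (suc i) m ++ factorAt w k n) (sym (+-suc i m)) ⟩
  factorAt w (suc i) m ++ factorAt w (i + suc m) n ∎)

factorAt-≡-++-∷ : {A : Set} (w : InfWord A) → ∀ i n x a r →
  factorAt w i n ≡ x ++ a ∷ r → factorAt w i (length x) ≡ x × w (i + length x) ≡ a
factorAt-≡-++-∷ w i (suc n) [] a r eq =
  refl , trans (cong w (+-identityʳ i)) (proj₁ (∷-injective eq))
factorAt-≡-++-∷ w i (suc n) (b ∷ x) a r eq with ∷-injective eq
... | wi≡b , rest with factorAt-≡-++-∷ w (suc i) n x a r rest
...   | x-matches , next = cong₂ _∷_ wi≡b x-matches , trans (cong w (+-suc i (length x))) next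

length-<-++-∷ : {A : Set} (x : List A) (a : A) (r : List A) → length x < length (x ++ a ∷ r)
length-<-++-∷ x a r = subst (length x <_) (sym (length-++-sucʳ x a r)) (s≤s (length-++-≤ˡ x))

-- Reading an infinite word w, from position p₀ on, as an image under a morphism h:
-- `next` cuts one block h c off at any position satisfying P and lands on P again.
module Parse {A B : Set} (h : A → List B) (w : InfWord B) (P : ℕ → Set)
  (next : ∀ p → P p → Σ A λ c → factorAt w p (length (h c)) ≡ h c × P (p + length (h c)))
  (p₀ : ℕ) (P₀ : P p₀) where

  cut : Σ ℕ P → Σ ℕ P
  cut (p , q) = p + length (h (proj₁ (next p q))) , proj₂ (proj₂ (next p q))

  state : ℕ → Σ ℕ P
  state zero = p₀ , P₀
  state (suc n) = cut (state n)

  position : ℕ → ℕ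
  position n = proj₁ (state n)

  letter : InfWord A
  letter n = proj₁ (next (position n) (proj₂ (state n)))

  factorAt-position : ∀ k n →
    factorAt w (position k) (length (concatMap h (factorAt letter k n))) ≡ concatMap h (factorAt letter k n)
  factorAt-position k zero = refl
  factorAt-position k (suc n) = begin
    factorAt w (position k) (length (h (letter k) ++ rest))
      ≡⟨ cong (factorAt w (position k)) (length-++ (h (letter k))) ⟩
    factorAt w (position k) (length (h (letter k)) + length rest)
      ≡⟨ factorAt-+ w (position k) (length (h (letter k))) (length rest) ⟩
    factorAt w (position k) (length (h (letter k))) ++ factorAt w (position (suc k)) (length rest)
      ≡⟨ cong₂ _++_ (proj₁ (proj₂ (next (position k) (proj₂ (state k))))) (factorAt-position (suc k) n) ⟩
    h (letter k) ++ rest ∎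
    where rest = concatMap h (factorAt letter (suc k) n)

  position-+ : ∀ i n → position (i + n) ≡ position i + length (concatMap h (factorAt letter i n))
  position-+ i zero = trans (cong position (+-identityʳ i)) (sym (+-identityʳ (position i)))
  position-+ i (suc n) = begin
    position (i + suc n)                     ≡⟨ cong position (+-suc i n) ⟩
    position (suc i + n)                     ≡⟨ position-+ (suc i) n ⟩
    position (suc i) + length rest           ≡⟨ +-assoc (position i) (length (h (letter i))) (length rest) ⟩
    position i + (length (h (letter i)) + length rest) ≡⟨ cong (position i +_) (sym (length-++ (h (letter i)))) ⟩
    position i + length (h (letter i) ++ rest) ∎
    where rest = concatMap h (factorAt letter (suc i) n)

  prefix-decomposition : ∀ n →
    prefix w (p₀ + length (concatMap h (prefix letter n))) ≡ prefix w p₀ ++ concatMap h (prefix letter n)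
  prefix-decomposition n = trans (factorAt-+ w 0 p₀ _) (cong (prefix w p₀ ++_) (factorAt-position 0 n))

  squareFree-letter : (∀ a → 1 ≤ length (h a)) → SquareFreeInf w → SquareFreeInf letter
  squareFree-letter nonerasing squareFree i (suc n) _ eq = squareFree (position i) m nonempty square
    where
    x = factorAt letter i (suc n)
    y = factorAt letter (i + suc n) (suc n)
    m = length (concatMap h x)

    nonempty : 1 ≤ m
    nonempty = subst (1 ≤_) (sym (length-++ (h (letter i))))
                     (≤-trans (nonerasing (letter i)) (m≤m+n _ _))

    square : factorAt w (position i) m ≡ factorAt w (position i + m) m
    square = begin
      factorAt w (position i) m                             ≡⟨ factorAt-position i (suc n) ⟩
      concatMap h x                                         ≡⟨ cong (concatMap h) eq ⟩
      concatMap h y                                         ≡⟨ sym (factorAt-position (i + suc n) (suc n)) ⟩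
      factorAt w (position (i + suc n)) (length (concatMap h y))
        ≡⟨ cong₂ (factorAt w) (position-+ i (suc n)) (cong (λ z → length (concatMap h z)) (sym eq)) ⟩
      factorAt w (position i + m) m                         ∎

data Adjacent : Σ₄ → Σ₄ → Set where
  a01 : Adjacent l0 l1
  a03 : Adjacent l0 l3
  a10 : Adjacent l1 l0
  a12 : Adjacent l1 l2
  a21 : Adjacent l2 l1
  a23 : Adjacent l2 l3
  a30 : Adjacent l3 l0
  a32 : Adjacent l3 l2

adjacent : ∀ a b → a ≢ b → ¬ Forbidden a b → Adjacent a b
adjacent zero zero a≢b _ = ⊥-elim (a≢b refl)
adjacent zero (suc zero) _ _ = a01
adjacent zero (suc (suc zero)) _ ¬f = ⊥-elim (¬f tt)
adjacent zero (suc (suc (suc zero))) _ _ = a03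
adjacent (suc zero) zero _ _ = a10
adjacent (suc zero) (suc zero) a≢b _ = ⊥-elim (a≢b refl)
adjacent (suc zero) (suc (suc zero)) _ _ = a12
adjacent (suc zero) (suc (suc (suc zero))) _ ¬f = ⊥-elim (¬f tt)
adjacent (suc (suc zero)) zero _ ¬f = ⊥-elim (¬f tt)
adjacent (suc (suc zero)) (suc zero) _ _ = a21
adjacent (suc (suc zero)) (suc (suc zero)) a≢b _ = ⊥-elim (a≢b refl)
adjacent (suc (suc zero)) (suc (suc (suc zero))) _ _ = a23
adjacent (suc (suc (suc zero))) zero _ _ = a30
adjacent (suc (suc (suc zero))) (suc zero) _ ¬f = ⊥-elim (¬f tt)
adjacent (suc (suc (suc zero))) (suc (suc zero)) _ _ = a32
adjacent (suc (suc (suc zero))) (suc (suc (suc zero))) a≢b _ = ⊥-elim (a≢b refl)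

dean-adjacent : ∀ {w} → DeanInf w → ∀ i → Adjacent (w i) (w (suc i))
dean-adjacent {w} (reduced , squareFree) i = adjacent (w i) (w (suc i)) distinct (reduced i)
  where
  distinct : w i ≢ w (suc i)
  distinct eq = squareFree i 1 (s≤s z≤n) (cong (_∷ []) (trans eq (cong w (sym (+-comm i 1)))))

data Excluded : Σ₄ → Σ₄ → Σ₄ → Set where
  x101 : Excluded l1 l0 l1
  x123 : Excluded l1 l2 l3
  x212 : Excluded l2 l1 l2
  x232 : Excluded l2 l3 l2
  x303 : Excluded l3 l0 l3
  x321 : Excluded l3 l2 l1

data AllowedTriple : Σ₄ → Σ₄ → Σ₄ → Set where
  t010 : AllowedTriple l0 l1 l0
  t012 : AllowedTriple l0 l1 l2
  t030 : AllowedTriple l0 l3 l0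
  t032 : AllowedTriple l0 l3 l2
  t103 : AllowedTriple l1 l0 l3
  t121 : AllowedTriple l1 l2 l1
  t210 : AllowedTriple l2 l1 l0
  t230 : AllowedTriple l2 l3 l0
  t301 : AllowedTriple l3 l0 l1
  t323 : AllowedTriple l3 l2 l3

allowedTriple : ∀ {a b c} → Adjacent a b → Adjacent b c → ¬ Excluded a b c → AllowedTriple a b c
allowedTriple a01 a10 _ = t010
allowedTriple a01 a12 _ = t012
allowedTriple a03 a30 _ = t030
allowedTriple a03 a32 _ = t032
allowedTriple a10 a01 ¬x = ⊥-elim (¬x x101)
allowedTriple a10 a03 _ = t103
allowedTriple a12 a21 _ = t121
allowedTriple a12 a23 ¬x = ⊥-elim (¬x x123)
allowedTriple a21 a10 _ = t210
allowedTriple a21 a12 ¬x = ⊥-elim (¬x x212)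
allowedTriple a23 a30 _ = t230
allowedTriple a23 a32 ¬x = ⊥-elim (¬x x232)
allowedTriple a30 a01 _ = t301
allowedTriple a30 a03 ¬x = ⊥-elim (¬x x303)
allowedTriple a32 a21 ¬x = ⊥-elim (¬x x321)
allowedTriple a32 a23 _ = t323

AllowedTriples : List Σ₄ → Set
AllowedTriples (a ∷ b ∷ c ∷ x) = AllowedTriple a b c × AllowedTriples (b ∷ c ∷ x)
AllowedTriples _ = ⊤

LocallyAllowed : InfWord Σ₄ → Set
LocallyAllowed w = ∀ i → AllowedTriple (w i) (w (suc i)) (w (suc (suc i)))

locallyAllowed : ∀ {w} → DeanInf w →
  InD3 w l1 l0 l1 → InD3 w l1 l2 l3 → InD3 w l2 l1 l2 →
  InD3 w l2 l3 l2 → InD3 w l3 l0 l3 → InD3 w l3 l2 l1 → LocallyAllowed w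
locallyAllowed {w} dean h₁ h₂ h₃ h₄ h₅ h₆ i =
  allowedTriple (dean-adjacent dean i) (dean-adjacent dean (suc i)) (λ x → absent x (i , refl))
  where
  absent : ∀ {a b c} → Excluded a b c → ¬ IsFactor (a ∷ b ∷ c ∷ []) w
  absent x101 = proj₁ (proj₂ h₁)
  absent x123 = proj₁ (proj₂ h₂)
  absent x212 = proj₁ (proj₂ h₃)
  absent x232 = proj₁ (proj₂ h₄)
  absent x303 = proj₁ (proj₂ h₅)
  absent x321 = proj₁ (proj₂ h₆)

allowedTriples-factorAt : ∀ {w} → LocallyAllowed w → ∀ i n → AllowedTriples (factorAt w i n)
allowedTriples-factorAt local i zero = tt
allowedTriples-factorAt local i (suc zero) = tt
allowedTriples-factorAt local i (suc (suc zero)) = tt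
allowedTriples-factorAt local i (suc (suc (suc n))) = local i , allowedTriples-factorAt local (suc i) (suc (suc n))

one-within-six : ∀ {a b c d e f} → AllowedTriples (a ∷ b ∷ c ∷ d ∷ e ∷ f ∷ []) →
  ∃₂ λ u r → a ∷ b ∷ c ∷ d ∷ e ∷ f ∷ [] ≡ u ++ l1 ∷ r
one-within-six (t103 , _) = [] , _ , refl
one-within-six (t121 , _) = [] , _ , refl
one-within-six (t010 , _) = l0 ∷ [] , _ , refl
one-within-six (t012 , _) = l0 ∷ [] , _ , refl
one-within-six (t030 , t301 , _) = l0 ∷ l3 ∷ l0 ∷ [] , _ , refl
one-within-six (t032 , t323 , t230 , t301 , _) = l0 ∷ l3 ∷ l2 ∷ l3 ∷ l0 ∷ [] , _ , refl
one-within-six (t210 , _) = l2 ∷ [] , _ , refl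
one-within-six (t230 , t301 , _) = l2 ∷ l3 ∷ l0 ∷ [] , _ , refl
one-within-six (t301 , _) = l3 ∷ l0 ∷ [] , _ , refl
one-within-six (t323 , t230 , t301 , _) = l3 ∷ l2 ∷ l3 ∷ l0 ∷ [] , _ , refl

block-after-one : ∀ {a b c d e f k} → a ≡ l1 → AllowedTriples (a ∷ b ∷ c ∷ d ∷ e ∷ f ∷ k ∷ []) →
  Σ Σ₃ λ s → ∃ λ r → a ∷ b ∷ c ∷ d ∷ e ∷ f ∷ k ∷ [] ≡ gLetter s ++ l1 ∷ r
block-after-one refl (t121 , _) = suc (suc zero) , _ , refl
block-after-one refl (t103 , t030 , t301 , _) = suc zero , _ , refl
block-after-one refl (t103 , t032 , t323 , t230 , t301 , _) = zero , _ , refl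

module _ {w : InfWord Σ₄} (local : LocallyAllowed w) where

  first-one : Σ (List Σ₄) λ u → length u ≤ 5 × prefix w (length u) ≡ u × w (length u) ≡ l1
  first-one with one-within-six (allowedTriples-factorAt local 0 6)
  ... | u , r , eq = u , ≤-pred (subst (length u <_) (cong length (sym eq)) (length-<-++-∷ u l1 r)) ,
                     factorAt-≡-++-∷ w 0 6 u l1 r eq

  gBlock-at-one : ∀ p → w p ≡ l1 →
    Σ Σ₃ λ s → factorAt w p (length (gLetter s)) ≡ gLetter s × w (p + length (gLetter s)) ≡ l1
  gBlock-at-one p wp≡1 with block-after-one wp≡1 (allowedTriples-factorAt local p 7)
  ... | s , r , eq = s , factorAt-≡-++-∷ w p 7 (gLetter s) l1 r eq

gLetter-nonempty : ∀ a → 1 ≤ length (gLetter a)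
gLetter-nonempty zero = s≤s z≤n
gLetter-nonempty (suc zero) = s≤s z≤n
gLetter-nonempty (suc (suc zero)) = s≤s z≤n

gImage-decomposition : ∀ {w} → SquareFreeInf w → LocallyAllowed w →
  Σ (List Σ₄) λ u → Σ (InfWord Σ₃) λ v → (length u ≤ 5) × SquareFreeInf v × EqConcatImage w u v
gImage-decomposition {w} squareFree local with first-one local
... | u , short , u-prefix , one =
  u , letter , short , squareFree-letter gLetter-nonempty squareFree ,
  λ n → trans (prefix-decomposition n) (cong (_++ g (prefix letter n)) u-prefix)
  where open Parse gLetter w (λ p → w p ≡ l1) (gBlock-at-one local) (length u) one

mainTheorem5 : (w : InfWord Σ₄) → DeanInf w →
    InD3 w l1 l0 l1 → InD3 w l1 l2 l3 → InD3 w l2 l1 l2 →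
    InD3 w l2 l3 l2 → InD3 w l3 l0 l3 → InD3 w l3 l2 l1 →
    Σ (List Σ₄) λ u → Σ (InfWord Σ₃) λ v →
    (length u ≤ 5) × SquareFreeInf v × EqConcatImage w u v
mainTheorem5 w dean h₁ h₂ h₃ h₄ h₅ h₆ =
  gImage-decomposition (proj₂ dean) (locallyAllowed dean h₁ h₂ h₃ h₄ h₅ h₆)
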